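{- Let $n$ be an even positive integer and let $S$ be an $n\times n$ Seidel matrix of a tournament. Then either $S$ is a skew-conference matrix or \[\det S\le (n-1)^{\frac{n-2}{2}}\sqrt{(n-1)^2-4}.\]
   Context: A tournament of order $n$ is a digraph on $\{1,\dots,n\}$ with exactly one of the arcs $ij$, $ji$ for each pair $i\ne j$. Its Seidel matrix $S=[s_{ij}]$ is the $n\times n$ skew-symmetric matrix with zero diagonal, $s_{ij}=1$ if $ij$ is an arc and $s_{ij}=-1$ otherwise. A skew-conference matrix of order $n$ is an $n\times n$ skew-symmetric matrix $C$ with entries in $\{0,\pm1\}$ such that $CC^\top=(n-1)I$. -}

module Defs where

open import Data.Nat as ℕ using (ℕ; zero; suc; _∸_)
open import Data.Integer as ℤ using (ℤ; +_; -_; _*_; _+_; _-_)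
open import Data.Fin using (Fin; zero; suc; punchIn; toℕ)
open import Data.Fin.Properties using (_≟_)
open import Data.Bool using (Bool; true; false; not; if_then_else_)
open import Data.Product using (_×_)
open import Relation.Binary.PropositionalEquality using (_≡_; _≢_)
open import Relation.Nullary using (yes; no)

Matrix : ℕ → Set
Matrix n = Fin n → Fin n → ℤ

sumF : ∀ {n} → (Fin n → ℤ) → ℤ
sumF {zero}  f = + 0
sumF {suc n} f = f zero + sumF (λ i → f (suc i))

sgn : ℕ → ℤ
sgn zero          = + 1
sgn (suc zero)    = - (+ 1)
sgn (suc (suc k)) = sgn k

det : ∀ {n} → Matrix n → ℤ
det {zero}  M = + 1
det {suc n} M =
  sumF (λ j → sgn (toℕ j) * M zero j * det (λ r c → M (suc r) (punchIn j c)))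

-- a tournament on Fin n: T i j = true iff ij is an arc
IsTournament : ∀ {n} → (Fin n → Fin n → Bool) → Set
IsTournament {n} T =
  (∀ (i : Fin n) → T i i ≡ false) × (∀ (i j : Fin n) → i ≢ j → T i j ≡ not (T j i))

seidel : ∀ {n} → (Fin n → Fin n → Bool) → Matrix n
seidel T i j with i ≟ j
... | yes _ = + 0
... | no  _ = if T i j then + 1 else - (+ 1)

IsTrit : ℤ → Set
IsTrit x = (x ≡ + 0) Data.Sum.⊎ ((x ≡ + 1) Data.Sum.⊎ (x ≡ - (+ 1)))
  where import Data.Sum

IsSkewConference : ∀ {n} → Matrix n → Set
IsSkewConference {n} C =
  (∀ i j → C j i ≡ - (C i j)) ×
  (∀ i j → IsTrit (C i j)) ×
  (∀ i j → sumF (λ k → C i k * C j k) ≡ (if isYes (i ≟ j) then + (n ∸ 1) else + 0))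
  where open import Relation.Nullary.Decidable using (isYes)

{-# OPTIONS --safe #-}

-- Let c₀, …, cₙ₋₁ be the columns of the Seidel matrix S. In the exterior algebra of ℤⁿ, det S is
-- the top coordinate of c₀ ∧ ⋯ ∧ cₙ₋₁. Moving two columns cᵢ, cⱼ to the front and peeling off the
-- others with Lagrange's identity ‖v ∧ w‖² + ‖v ⌟ w‖² = ‖v‖² ‖w‖² gives
--   (det S)² ≤ (‖cᵢ‖² ‖cⱼ‖² − ⟨cᵢ , cⱼ⟩²) ∏ₜ ‖cₜ‖².
-- Every column of S has squared norm n − 1, and by skew-symmetry ⟨cᵢ , cⱼ⟩ is the inner product of
-- rows i and j, a sum of n − 2 signs, hence even as n is. So if S is not skew-conference, some
-- ⟨cᵢ , cⱼ⟩ with i ≠ j is nonzero, its square is at least 4, and (det S)² ≤ (n−1)ⁿ⁻² ((n−1)² − 4).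

module Submission where

open import Defs
open import Data.Bool using (Bool; true; false; if_then_else_)
open import Data.Empty using (⊥-elim)
open import Data.Fin using (Fin; zero; suc; punchIn; punchOut; toℕ)
open import Data.Fin.Patterns using (0F; 1F; 2F; 3F)
open import Data.Fin.Properties using (_≟_; any?; punchInᵢ≢i; punchIn-injective; punchIn-punchOut)
open import Data.Integer as ℤ using (ℤ; +_; -_; -1ℤ; _*_; _+_; _-_; _≤_; +≤+; nonNegative)
open import Data.Integer.Divisibility.Signed using (divides; ∣-refl; ∣m∣n⇒∣m+n; ∣m+n∣n⇒∣m; ∣ᵤ⇒∣)
  renaming (_∣_ to _∣ℤ_)
import Data.Integer.Properties as ℤP
open import Data.Integer.Tactic.RingSolver using (solve-∀)
open import Data.Nat as ℕ using (ℕ; zero; suc; z≤n; s≤s; _≥_; _∸_; _^_)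
open import Data.Nat.Divisibility using (_∣_)
import Data.Nat.Divisibility as ℕ∣
import Data.Nat.Properties as ℕP
open import Data.Product using (_×_; _,_; proj₁; proj₂)
open import Data.Sum using (_⊎_; inj₁; inj₂)
open import Data.Unit using (⊤; tt)
open import Data.Vec using (Vec; []; _∷_; lookup; map)
open import Data.Vec.Properties using (lookup-map)
open import Data.Vec.Functional using (Vector; head; tail; removeAt)
open import Function using (_∘_; case_of_)
open import Relation.Binary.PropositionalEquality
  using (_≡_; _≢_; refl; sym; trans; cong; cong₂; subst; module ≡-Reasoning)
open import Relation.Nullary using (yes; no)
open import Relation.Nullary.Decidable using (isYes; ¬?; decidable-stable)
open import Algebra.Definitions.RawMonoid ℤ.*-1-rawMonoid using () renaming (sum to ∏)
open import Algebra.Properties.CommutativeMonoid.Sum ℤP.+-0-commutativeMonoid using (sum-remove)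
  renaming (sum to ∑)

sumF-cong : ∀ {n} {f g : Fin n → ℤ} → (∀ i → f i ≡ g i) → sumF f ≡ sumF g
sumF-cong {zero}  f≗g = refl
sumF-cong {suc n} f≗g = cong₂ _+_ (f≗g zero) (sumF-cong (f≗g ∘ suc))

sumF≡sum : ∀ {n} (f : Fin n → ℤ) → sumF f ≡ ∑ f
sumF≡sum {zero}  f = refl
sumF≡sum {suc n} f = cong (_+_ (head f)) (sumF≡sum (tail f))

sumF-removeAt : ∀ {n} (f : Fin (suc n) → ℤ) (i : Fin (suc n)) → sumF f ≡ f i + sumF (removeAt f i)
sumF-removeAt f i = begin
  sumF f                     ≡⟨ sumF≡sum f ⟩
  ∑ f                        ≡⟨ sum-remove f ⟩
  f i + ∑ (removeAt f i)     ≡⟨ cong (_+_ (f i)) (sumF≡sum (removeAt f i)) ⟨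
  f i + sumF (removeAt f i)  ∎
  where open ≡-Reasoning

sumF-ones : ∀ {n} {f : Fin n → ℤ} → (∀ i → f i ≡ + 1) → sumF f ≡ + n
sumF-ones {zero}  f≡1 = refl
sumF-ones {suc n} f≡1 = cong₂ _+_ (f≡1 zero) (sumF-ones (f≡1 ∘ suc))

∏-const : ∀ {n a} {f : Fin n → ℤ} → (∀ i → f i ≡ + a) → ∏ f ≡ + (a ^ n)
∏-const {zero}      f≡a = refl
∏-const {suc n} {a} f≡a = trans (cong₂ _*_ (f≡a zero) (∏-const (f≡a ∘ suc))) (sym (ℤP.pos-* a (a ^ n)))

sgn-suc : ∀ t → sgn (suc t) ≡ -1ℤ * sgn t
sgn-suc zero          = refl
sgn-suc (suc zero)    = refl
sgn-suc (suc (suc t)) = sgn-suc t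

sgn*sgn : ∀ t → sgn t * sgn t ≡ + 1
sgn*sgn zero          = refl
sgn*sgn (suc zero)    = refl
sgn*sgn (suc (suc t)) = sgn*sgn t

x*x≥0 : ∀ x → + 0 ≤ x * x
x*x≥0 (+ n)      = subst (+ 0 ≤_) (ℤP.pos-* n n) (+≤+ z≤n)
x*x≥0 (ℤ.-[1+ n ]) = +≤+ z≤n

-- Exterior powers of ℤᵐ

-- Λ k m is the k-th exterior power of ℤᵐ. With basis e₀, …, eₘ₋₁ of ℤᵐ, a pair (x , y) in
-- Λ (suc k) (suc m) stands for x + e₀ ∧ y, where x and y involve only e₁, …, eₘ₋₁.
Λ : ℕ → ℕ → Set
Λ zero    m       = ℤ
Λ (suc k) zero    = ⊤
Λ (suc k) (suc m) = Λ (suc k) m × Λ k m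

0Λ : ∀ {k m} → Λ k m
0Λ {zero}          = + 0
0Λ {suc k} {zero}  = tt
0Λ {suc k} {suc m} = 0Λ , 0Λ

infixl 6 _⊕_
infixr 7 _⊙_

_⊕_ : ∀ {k m} → Λ k m → Λ k m → Λ k m
_⊕_ {zero}          x       y         = x + y
_⊕_ {suc k} {zero}  _       _         = tt
_⊕_ {suc k} {suc m} (x , y) (x′ , y′) = x ⊕ x′ , y ⊕ y′

_⊙_ : ∀ {k m} → ℤ → Λ k m → Λ k m
_⊙_ {zero}          s x       = s * x
_⊙_ {suc k} {zero}  s _       = tt
_⊙_ {suc k} {suc m} s (x , y) = s ⊙ x , s ⊙ y

infixl 6 _‵⊕_
infixr 7 _‵⊙_

data LinExpr (r : ℕ) : Set where
  var   : Fin r → LinExpr r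
  ‵0    : LinExpr r
  _‵⊕_  : LinExpr r → LinExpr r → LinExpr r
  _‵⊙_  : ℤ → LinExpr r → LinExpr r

⟦_⟧ : ∀ {r k m} → LinExpr r → Vec (Λ k m) r → Λ k m
⟦ var i  ⟧ xs = lookup xs i
⟦ ‵0     ⟧ xs = 0Λ
⟦ e ‵⊕ f ⟧ xs = ⟦ e ⟧ xs ⊕ ⟦ f ⟧ xs
⟦ s ‵⊙ e ⟧ xs = s ⊙ ⟦ e ⟧ xs

⟦⟧-split : ∀ {r k m} (e : LinExpr r) (xs : Vec (Λ (suc k) (suc m)) r) →
           ⟦ e ⟧ xs ≡ (⟦ e ⟧ (map proj₁ xs) , ⟦ e ⟧ (map proj₂ xs))
⟦⟧-split (var i)  xs = sym (cong₂ _,_ (lookup-map i proj₁ xs) (lookup-map i proj₂ xs))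
⟦⟧-split ‵0       xs = refl
⟦⟧-split (e ‵⊕ f) xs = cong₂ _⊕_ (⟦⟧-split e xs) (⟦⟧-split f xs)
⟦⟧-split (s ‵⊙ e) xs = cong (s ⊙_) (⟦⟧-split e xs)

-- Λ k m is a finite product of copies of Λ 0 m′ = ℤ, so a linear identity valid in ℤ holds in it
-- coordinatewise.
linear-identity : ∀ {r k m} (e f : LinExpr r) →
                  (∀ {m} (zs : Vec ℤ r) → ⟦_⟧ {k = 0} {m} e zs ≡ ⟦_⟧ {k = 0} {m} f zs) →
                  (xs : Vec (Λ k m) r) → ⟦ e ⟧ xs ≡ ⟦ f ⟧ xs
linear-identity {k = zero}              e f holds xs = holds xs
linear-identity {k = suc k} {m = zero}  e f holds xs = refl
linear-identity {k = suc k} {m = suc m} e f holds xs = begin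
  ⟦ e ⟧ xs                                    ≡⟨ ⟦⟧-split e xs ⟩
  (⟦ e ⟧ (map proj₁ xs) , ⟦ e ⟧ (map proj₂ xs)) ≡⟨ cong₂ _,_ (linear-identity e f holds _) (linear-identity e f holds _) ⟩
  (⟦ f ⟧ (map proj₁ xs) , ⟦ f ⟧ (map proj₂ xs)) ≡⟨ ⟦⟧-split f xs ⟨
  ⟦ f ⟧ xs                                    ∎
  where open ≡-Reasoning

⊙-distrib-⊕ : ∀ {k m} (s : ℤ) (x y : Λ k m) → s ⊙ (x ⊕ y) ≡ s ⊙ x ⊕ s ⊙ y
⊙-distrib-⊕ s x y = linear-identity (s ‵⊙ (var 0F ‵⊕ var 1F)) (s ‵⊙ var 0F ‵⊕ s ‵⊙ var 1F)
  (λ { (a ∷ b ∷ []) → lemma s a b }) (x ∷ y ∷ [])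
  where lemma : ∀ s a b → s * (a + b) ≡ s * a + s * b
        lemma = solve-∀

⊙-zero : ∀ {k m} (s : ℤ) → s ⊙ 0Λ {k} {m} ≡ 0Λ
⊙-zero s = linear-identity (s ‵⊙ ‵0) ‵0 (λ { [] → lemma s }) []
  where lemma : ∀ s → s * + 0 ≡ + 0
        lemma = solve-∀

⊙-assoc : ∀ {k m} (s t : ℤ) (x : Λ k m) → s ⊙ t ⊙ x ≡ (s * t) ⊙ x
⊙-assoc s t x = linear-identity (s ‵⊙ t ‵⊙ var 0F) ((s * t) ‵⊙ var 0F) (λ { (a ∷ []) → lemma s t a }) (x ∷ [])
  where lemma : ∀ s t a → s * (t * a) ≡ s * t * a
        lemma = solve-∀

⊙-identity : ∀ {k m} (x : Λ k m) → + 1 ⊙ x ≡ x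
⊙-identity x = linear-identity (+ 1 ‵⊙ var 0F) (var 0F) (λ { (a ∷ []) → lemma a }) (x ∷ [])
  where lemma : ∀ a → + 1 * a ≡ a
        lemma = solve-∀

∑Λ : ∀ {n k m} → (Fin n → Λ k m) → Λ k m
∑Λ {zero}  f = 0Λ
∑Λ {suc n} f = head f ⊕ ∑Λ (tail f)

∑Λ-cong : ∀ {n k m} {f g : Fin n → Λ k m} → (∀ i → f i ≡ g i) → ∑Λ f ≡ ∑Λ g
∑Λ-cong {zero}  f≗g = refl
∑Λ-cong {suc n} f≗g = cong₂ _⊕_ (f≗g zero) (∑Λ-cong (f≗g ∘ suc))

⊙-∑Λ : ∀ {n k m} (s : ℤ) (f : Fin n → Λ k m) → s ⊙ ∑Λ f ≡ ∑Λ (λ i → s ⊙ f i)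
⊙-∑Λ {zero}  s f = ⊙-zero s
⊙-∑Λ {suc n} s f = trans (⊙-distrib-⊕ s (head f) (∑Λ (tail f))) (cong (s ⊙ head f ⊕_) (⊙-∑Λ s (tail f)))

infixr 7 _∧_ _⌟_

-- For v = v₀ e₀ + v′ and w = w₁ + e₀ ∧ w₂: v ∧ w = v′ ∧ w₁ + e₀ ∧ (v₀ w₁ − v′ ∧ w₂).
_∧_ : ∀ {k m} → Vector ℤ m → Λ k m → Λ (suc k) m
_∧_ {k}     {zero}  v w        = tt
_∧_ {zero}  {suc m} v w        = tail v ∧ w , head v * w
_∧_ {suc k} {suc m} v (w , w′) = tail v ∧ w , head v ⊙ w ⊕ -1ℤ ⊙ (tail v ∧ w′)

_⌟_ : ∀ {k m} → Vector ℤ m → Λ (suc k) m → Λ k m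
_⌟_ {k}     {zero}  v w        = 0Λ
_⌟_ {zero}  {suc m} v (w , w′) = tail v ⌟ w + head v * w′
_⌟_ {suc k} {suc m} v (w , w′) = tail v ⌟ w ⊕ head v ⊙ w′ , -1ℤ ⊙ (tail v ⌟ w′)

∧-zero : ∀ {k m} (v : Vector ℤ m) → v ∧ 0Λ {k} ≡ 0Λ
∧-zero {k}     {zero}  v = refl
∧-zero {zero}  {suc m} v = cong₂ _,_ (∧-zero (tail v)) (ℤP.*-zeroʳ (head v))
∧-zero {suc k} {suc m} v = cong₂ _,_ (∧-zero (tail v)) (begin
  head v ⊙ 0Λ ⊕ -1ℤ ⊙ (tail v ∧ 0Λ)
    ≡⟨ cong (λ t → head v ⊙ 0Λ ⊕ -1ℤ ⊙ t) (∧-zero (tail v)) ⟩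
  head v ⊙ 0Λ ⊕ -1ℤ ⊙ 0Λ
    ≡⟨ linear-identity (head v ‵⊙ ‵0 ‵⊕ -1ℤ ‵⊙ ‵0) ‵0 (λ { [] → lemma (head v) }) [] ⟩
  0Λ ∎)
  where open ≡-Reasoning
        lemma : ∀ a → a * + 0 + -1ℤ * + 0 ≡ + 0
        lemma = solve-∀

∧-distrib-⊕ : ∀ {k m} (v : Vector ℤ m) (x y : Λ k m) → v ∧ (x ⊕ y) ≡ v ∧ x ⊕ v ∧ y
∧-distrib-⊕ {k}     {zero}  v x y = refl
∧-distrib-⊕ {zero}  {suc m} v x y = cong₂ _,_ (∧-distrib-⊕ (tail v) x y) (ℤP.*-distribˡ-+ (head v) x y)
∧-distrib-⊕ {suc k} {suc m} v (x , x′) (y , y′) = cong₂ _,_ (∧-distrib-⊕ (tail v) x y) (begin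
  head v ⊙ (x ⊕ y) ⊕ -1ℤ ⊙ (tail v ∧ (x′ ⊕ y′))
    ≡⟨ cong (λ t → head v ⊙ (x ⊕ y) ⊕ -1ℤ ⊙ t) (∧-distrib-⊕ (tail v) x′ y′) ⟩
  head v ⊙ (x ⊕ y) ⊕ -1ℤ ⊙ (tail v ∧ x′ ⊕ tail v ∧ y′)
    ≡⟨ linear-identity (a ‵⊙ (var 0F ‵⊕ var 1F) ‵⊕ -1ℤ ‵⊙ (var 2F ‵⊕ var 3F))
                       ((a ‵⊙ var 0F ‵⊕ -1ℤ ‵⊙ var 2F) ‵⊕ (a ‵⊙ var 1F ‵⊕ -1ℤ ‵⊙ var 3F))
                       (λ { (p ∷ q ∷ r ∷ s ∷ []) → lemma a p q r s })
                       (x ∷ y ∷ tail v ∧ x′ ∷ tail v ∧ y′ ∷ []) ⟩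
  (head v ⊙ x ⊕ -1ℤ ⊙ (tail v ∧ x′)) ⊕ (head v ⊙ y ⊕ -1ℤ ⊙ (tail v ∧ y′)) ∎)
  where open ≡-Reasoning
        a = head v
        lemma : ∀ a p q r s → a * (p + q) + -1ℤ * (r + s) ≡ (a * p + -1ℤ * r) + (a * q + -1ℤ * s)
        lemma = solve-∀

∧-⊙ : ∀ {k m} (v : Vector ℤ m) (s : ℤ) (x : Λ k m) → v ∧ s ⊙ x ≡ s ⊙ v ∧ x
∧-⊙ {k}     {zero}  v s x = refl
∧-⊙ {zero}  {suc m} v s x = cong₂ _,_ (∧-⊙ (tail v) s x) (lemma (head v) s x)
  where lemma : ∀ a s x → a * (s * x) ≡ s * (a * x)
        lemma = solve-∀
∧-⊙ {suc k} {suc m} v s (x , x′) = cong₂ _,_ (∧-⊙ (tail v) s x) (begin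
  a ⊙ s ⊙ x ⊕ -1ℤ ⊙ (tail v ∧ s ⊙ x′) ≡⟨ cong (λ t → a ⊙ s ⊙ x ⊕ -1ℤ ⊙ t) (∧-⊙ (tail v) s x′) ⟩
  a ⊙ s ⊙ x ⊕ -1ℤ ⊙ s ⊙ (tail v ∧ x′) ≡⟨ linear-identity (a ‵⊙ s ‵⊙ var 0F ‵⊕ -1ℤ ‵⊙ s ‵⊙ var 1F)
                                                          (s ‵⊙ (a ‵⊙ var 0F ‵⊕ -1ℤ ‵⊙ var 1F))
                                                          (λ { (p ∷ q ∷ []) → lemma a s p q })
                                                          (x ∷ tail v ∧ x′ ∷ []) ⟩
  s ⊙ (a ⊙ x ⊕ -1ℤ ⊙ (tail v ∧ x′))   ∎)
  where open ≡-Reasoning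
        a = head v
        lemma : ∀ a s p q → a * (s * p) + -1ℤ * (s * q) ≡ s * (a * p + -1ℤ * q)
        lemma = solve-∀

∧-linear : ∀ {k m} (v : Vector ℤ m) (s t : ℤ) (x y : Λ k m) → v ∧ (s ⊙ x ⊕ t ⊙ y) ≡ s ⊙ v ∧ x ⊕ t ⊙ v ∧ y
∧-linear v s t x y = trans (∧-distrib-⊕ v (s ⊙ x) (t ⊙ y)) (cong₂ _⊕_ (∧-⊙ v s x) (∧-⊙ v t y))

∧-∑Λ : ∀ {n k m} (v : Vector ℤ m) (f : Fin n → Λ k m) → v ∧ ∑Λ f ≡ ∑Λ (λ i → v ∧ f i)
∧-∑Λ {zero}  v f = ∧-zero v
∧-∑Λ {suc n} v f = trans (∧-distrib-⊕ v (head f) (∑Λ (tail f))) (cong (v ∧ head f ⊕_) (∧-∑Λ v (tail f)))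

∧-anticomm : ∀ {k m} (a b : Vector ℤ m) (w : Λ k m) → a ∧ b ∧ w ≡ -1ℤ ⊙ b ∧ a ∧ w
∧-anticomm {k}     {zero}  a b w = refl
∧-anticomm {zero}  {suc m} a b w = cong₂ _,_ (∧-anticomm (tail a) (tail b) w) (begin
  a₀ ⊙ (tail b ∧ w) ⊕ -1ℤ ⊙ (tail a ∧ (b₀ * w))
    ≡⟨ cong (λ t → a₀ ⊙ (tail b ∧ w) ⊕ -1ℤ ⊙ t) (∧-⊙ (tail a) b₀ w) ⟩
  a₀ ⊙ (tail b ∧ w) ⊕ -1ℤ ⊙ b₀ ⊙ (tail a ∧ w)
    ≡⟨ linear-identity (a₀ ‵⊙ var 0F ‵⊕ -1ℤ ‵⊙ b₀ ‵⊙ var 1F)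
                       (-1ℤ ‵⊙ (b₀ ‵⊙ var 1F ‵⊕ -1ℤ ‵⊙ a₀ ‵⊙ var 0F))
                       (λ { (p ∷ q ∷ []) → lemma a₀ b₀ p q })
                       (tail b ∧ w ∷ tail a ∧ w ∷ []) ⟩
  -1ℤ ⊙ (b₀ ⊙ (tail a ∧ w) ⊕ -1ℤ ⊙ a₀ ⊙ (tail b ∧ w))
    ≡⟨ cong (λ t → -1ℤ ⊙ (b₀ ⊙ (tail a ∧ w) ⊕ -1ℤ ⊙ t)) (∧-⊙ (tail b) a₀ w) ⟨
  -1ℤ ⊙ (b₀ ⊙ (tail a ∧ w) ⊕ -1ℤ ⊙ (tail b ∧ (a₀ * w))) ∎)
  where open ≡-Reasoning
        a₀ = head a
        b₀ = head b
        lemma : ∀ a b p q → a * p + -1ℤ * (b * q) ≡ -1ℤ * (b * q + -1ℤ * (a * p))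
        lemma = solve-∀
∧-anticomm {suc k} {suc m} a b (w , w′) = cong₂ _,_ (∧-anticomm (tail a) (tail b) w) (begin
  a₀ ⊙ (tail b ∧ w) ⊕ -1ℤ ⊙ (tail a ∧ (b₀ ⊙ w ⊕ -1ℤ ⊙ (tail b ∧ w′)))
    ≡⟨ cong (λ t → a₀ ⊙ (tail b ∧ w) ⊕ -1ℤ ⊙ t) (∧-linear (tail a) b₀ -1ℤ w (tail b ∧ w′)) ⟩
  a₀ ⊙ (tail b ∧ w) ⊕ -1ℤ ⊙ (b₀ ⊙ (tail a ∧ w) ⊕ -1ℤ ⊙ (tail a ∧ tail b ∧ w′))
    ≡⟨ cong (λ t → a₀ ⊙ (tail b ∧ w) ⊕ -1ℤ ⊙ (b₀ ⊙ (tail a ∧ w) ⊕ -1ℤ ⊙ t)) (∧-anticomm (tail a) (tail b) w′) ⟩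
  a₀ ⊙ (tail b ∧ w) ⊕ -1ℤ ⊙ (b₀ ⊙ (tail a ∧ w) ⊕ -1ℤ ⊙ -1ℤ ⊙ (tail b ∧ tail a ∧ w′))
    ≡⟨ linear-identity (a₀ ‵⊙ var 0F ‵⊕ -1ℤ ‵⊙ (b₀ ‵⊙ var 1F ‵⊕ -1ℤ ‵⊙ -1ℤ ‵⊙ var 2F))
                       (-1ℤ ‵⊙ (b₀ ‵⊙ var 1F ‵⊕ -1ℤ ‵⊙ (a₀ ‵⊙ var 0F ‵⊕ -1ℤ ‵⊙ var 2F)))
                       (λ { (p ∷ q ∷ r ∷ []) → lemma a₀ b₀ p q r })
                       (tail b ∧ w ∷ tail a ∧ w ∷ tail b ∧ tail a ∧ w′ ∷ []) ⟩
  -1ℤ ⊙ (b₀ ⊙ (tail a ∧ w) ⊕ -1ℤ ⊙ (a₀ ⊙ (tail b ∧ w) ⊕ -1ℤ ⊙ (tail b ∧ tail a ∧ w′)))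
    ≡⟨ cong (λ t → -1ℤ ⊙ (b₀ ⊙ (tail a ∧ w) ⊕ -1ℤ ⊙ t)) (∧-linear (tail b) a₀ -1ℤ w (tail a ∧ w′)) ⟨
  -1ℤ ⊙ (b₀ ⊙ (tail a ∧ w) ⊕ -1ℤ ⊙ (tail b ∧ (a₀ ⊙ w ⊕ -1ℤ ⊙ (tail a ∧ w′)))) ∎)
  where open ≡-Reasoning
        a₀ = head a
        b₀ = head b
        lemma : ∀ a b p q r → a * p + -1ℤ * (b * q + -1ℤ * (-1ℤ * r)) ≡ -1ℤ * (b * q + -1ℤ * (a * p + -1ℤ * r))
        lemma = solve-∀

∧-rotate : ∀ {k m} (a b y : Vector ℤ m) (w : Λ k m) → a ∧ b ∧ y ∧ w ≡ y ∧ a ∧ b ∧ w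
∧-rotate a b y w = begin
  a ∧ b ∧ y ∧ w                   ≡⟨ cong (a ∧_) (∧-anticomm b y w) ⟩
  a ∧ -1ℤ ⊙ y ∧ b ∧ w             ≡⟨ ∧-⊙ a -1ℤ (y ∧ b ∧ w) ⟩
  -1ℤ ⊙ a ∧ y ∧ b ∧ w             ≡⟨ cong (-1ℤ ⊙_) (∧-anticomm a y (b ∧ w)) ⟩
  -1ℤ ⊙ -1ℤ ⊙ y ∧ a ∧ b ∧ w       ≡⟨ ⊙-assoc -1ℤ -1ℤ (y ∧ a ∧ b ∧ w) ⟩
  + 1 ⊙ y ∧ a ∧ b ∧ w             ≡⟨ ⊙-identity (y ∧ a ∧ b ∧ w) ⟩
  y ∧ a ∧ b ∧ w                   ∎
  where open ≡-Reasoning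

⋀ : ∀ {k m} → (Fin k → Vector ℤ m) → Λ k m
⋀ {zero}  c = + 1
⋀ {suc k} c = head c ∧ ⋀ (tail c)

⋀-tails : ∀ {k m} (c : Fin (suc k) → Vector ℤ (suc m)) → proj₁ (⋀ c) ≡ ⋀ (tail ∘ c)
⋀-tails {zero}  c = refl
⋀-tails {suc k} c = cong (tail (head c) ∧_) (⋀-tails (tail c))

⋀-extract : ∀ {k m} (c : Fin (suc k) → Vector ℤ m) (j : Fin (suc k)) →
            ⋀ c ≡ sgn (toℕ j) ⊙ c j ∧ ⋀ (removeAt c j)
⋀-extract c zero = sym (⊙-identity (⋀ c))
⋀-extract {suc k} c (suc j) = begin
  head c ∧ ⋀ (tail c)
    ≡⟨ cong (head c ∧_) (⋀-extract (tail c) j) ⟩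
  head c ∧ s ⊙ c (suc j) ∧ W
    ≡⟨ ∧-⊙ (head c) s (c (suc j) ∧ W) ⟩
  s ⊙ head c ∧ c (suc j) ∧ W
    ≡⟨ cong (s ⊙_) (∧-anticomm (head c) (c (suc j)) W) ⟩
  s ⊙ -1ℤ ⊙ c (suc j) ∧ head c ∧ W
    ≡⟨ ⊙-assoc s -1ℤ (c (suc j) ∧ head c ∧ W) ⟩
  (s * -1ℤ) ⊙ c (suc j) ∧ head c ∧ W
    ≡⟨ cong (_⊙ c (suc j) ∧ head c ∧ W) (trans (ℤP.*-comm s -1ℤ) (sym (sgn-suc (toℕ j)))) ⟩
  sgn (suc (toℕ j)) ⊙ c (suc j) ∧ head c ∧ W ∎
  where
  open ≡-Reasoning
  s = sgn (toℕ j)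
  W = ⋀ (removeAt (tail c) j)

-- Inner products and Lagrange's identity

⟨_,_⟩ : ∀ {k m} → Λ k m → Λ k m → ℤ
⟨_,_⟩ {zero}          x       y         = x * y
⟨_,_⟩ {suc k} {zero}  _       _         = + 0
⟨_,_⟩ {suc k} {suc m} (x , y) (x′ , y′) = ⟨ x , x′ ⟩ + ⟨ y , y′ ⟩

‖_‖² : ∀ {k m} → Λ k m → ℤ
‖ x ‖² = ⟨ x , x ⟩

infix 7 _·_

_·_ : ∀ {m} → Vector ℤ m → Vector ℤ m → ℤ
u · v = sumF (λ i → u i * v i)

⟨⟩-comm : ∀ {k m} (x y : Λ k m) → ⟨ x , y ⟩ ≡ ⟨ y , x ⟩
⟨⟩-comm {zero}          x       y         = ℤP.*-comm x y
⟨⟩-comm {suc k} {zero}  _       _         = refl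
⟨⟩-comm {suc k} {suc m} (x , y) (x′ , y′) = cong₂ _+_ (⟨⟩-comm x x′) (⟨⟩-comm y y′)

⟨⟩-0ˡ : ∀ {k m} (y : Λ k m) → ⟨ 0Λ , y ⟩ ≡ + 0
⟨⟩-0ˡ {zero}          y        = refl
⟨⟩-0ˡ {suc k} {zero}  _        = refl
⟨⟩-0ˡ {suc k} {suc m} (y , y′) = cong₂ _+_ (⟨⟩-0ˡ y) (⟨⟩-0ˡ y′)

⟨⟩-⊕ˡ : ∀ {k m} (x y z : Λ k m) → ⟨ x ⊕ y , z ⟩ ≡ ⟨ x , z ⟩ + ⟨ y , z ⟩
⟨⟩-⊕ˡ {zero}          x        y        z        = ℤP.*-distribʳ-+ z x y
⟨⟩-⊕ˡ {suc k} {zero}  _        _        _        = refl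
⟨⟩-⊕ˡ {suc k} {suc m} (x , x′) (y , y′) (z , z′) =
  trans (cong₂ _+_ (⟨⟩-⊕ˡ x y z) (⟨⟩-⊕ˡ x′ y′ z′)) (interchange ⟨ x , z ⟩ ⟨ y , z ⟩ ⟨ x′ , z′ ⟩ ⟨ y′ , z′ ⟩)
  where interchange : ∀ p q r s → (p + q) + (r + s) ≡ (p + r) + (q + s)
        interchange = solve-∀

⟨⟩-⊕ʳ : ∀ {k m} (x y z : Λ k m) → ⟨ x , y ⊕ z ⟩ ≡ ⟨ x , y ⟩ + ⟨ x , z ⟩
⟨⟩-⊕ʳ x y z = begin
  ⟨ x , y ⊕ z ⟩         ≡⟨ ⟨⟩-comm x (y ⊕ z) ⟩
  ⟨ y ⊕ z , x ⟩         ≡⟨ ⟨⟩-⊕ˡ y z x ⟩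
  ⟨ y , x ⟩ + ⟨ z , x ⟩ ≡⟨ cong₂ _+_ (⟨⟩-comm y x) (⟨⟩-comm z x) ⟩
  ⟨ x , y ⟩ + ⟨ x , z ⟩ ∎
  where open ≡-Reasoning

⟨⟩-⊙ˡ : ∀ {k m} (s : ℤ) (x y : Λ k m) → ⟨ s ⊙ x , y ⟩ ≡ s * ⟨ x , y ⟩
⟨⟩-⊙ˡ {zero}          s x        y        = ℤP.*-assoc s x y
⟨⟩-⊙ˡ {suc k} {zero}  s _        _        = sym (ℤP.*-zeroʳ s)
⟨⟩-⊙ˡ {suc k} {suc m} s (x , x′) (y , y′) =
  trans (cong₂ _+_ (⟨⟩-⊙ˡ s x y) (⟨⟩-⊙ˡ s x′ y′)) (sym (ℤP.*-distribˡ-+ s ⟨ x , y ⟩ ⟨ x′ , y′ ⟩))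

⟨⟩-⊙ʳ : ∀ {k m} (s : ℤ) (x y : Λ k m) → ⟨ x , s ⊙ y ⟩ ≡ s * ⟨ x , y ⟩
⟨⟩-⊙ʳ s x y = trans (⟨⟩-comm x (s ⊙ y)) (trans (⟨⟩-⊙ˡ s y x) (cong (s *_) (⟨⟩-comm y x)))

‖⊙‖² : ∀ {k m} (s : ℤ) (x : Λ k m) → ‖ s ⊙ x ‖² ≡ s * s * ‖ x ‖²
‖⊙‖² s x = begin
  ⟨ s ⊙ x , s ⊙ x ⟩ ≡⟨ ⟨⟩-⊙ˡ s x (s ⊙ x) ⟩
  s * ⟨ x , s ⊙ x ⟩ ≡⟨ cong (s *_) (⟨⟩-⊙ʳ s x x) ⟩
  s * (s * ‖ x ‖²)  ≡⟨ ℤP.*-assoc s s ‖ x ‖² ⟨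
  s * s * ‖ x ‖²    ∎
  where open ≡-Reasoning

‖sgn⊙‖² : ∀ {k m} (t : ℕ) (x : Λ k m) → ‖ sgn t ⊙ x ‖² ≡ ‖ x ‖²
‖sgn⊙‖² t x = trans (‖⊙‖² (sgn t) x) (trans (cong (_* ‖ x ‖²) (sgn*sgn t)) (ℤP.*-identityˡ ‖ x ‖²))

‖⊕⊙‖² : ∀ {k m} (x : Λ k m) (t : ℤ) (y : Λ k m) →
        ‖ x ⊕ t ⊙ y ‖² ≡ ‖ x ‖² + + 2 * t * ⟨ x , y ⟩ + t * t * ‖ y ‖²
‖⊕⊙‖² x t y = begin
  ⟨ x ⊕ t ⊙ y , x ⊕ t ⊙ y ⟩
    ≡⟨ ⟨⟩-⊕ˡ x (t ⊙ y) (x ⊕ t ⊙ y) ⟩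
  ⟨ x , x ⊕ t ⊙ y ⟩ + ⟨ t ⊙ y , x ⊕ t ⊙ y ⟩
    ≡⟨ cong₂ _+_ (⟨⟩-⊕ʳ x x (t ⊙ y)) (⟨⟩-⊕ʳ (t ⊙ y) x (t ⊙ y)) ⟩
  (‖ x ‖² + ⟨ x , t ⊙ y ⟩) + (⟨ t ⊙ y , x ⟩ + ‖ t ⊙ y ‖²)
    ≡⟨ cong₂ (λ p q → (‖ x ‖² + p) + (q + ‖ t ⊙ y ‖²)) (⟨⟩-⊙ʳ t x y) (trans (⟨⟩-⊙ˡ t y x) (cong (t *_) (⟨⟩-comm y x))) ⟩
  (‖ x ‖² + t * ⟨ x , y ⟩) + (t * ⟨ x , y ⟩ + ‖ t ⊙ y ‖²)
    ≡⟨ cong (λ p → (‖ x ‖² + t * ⟨ x , y ⟩) + (t * ⟨ x , y ⟩ + p)) (‖⊙‖² t y) ⟩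
  (‖ x ‖² + t * ⟨ x , y ⟩) + (t * ⟨ x , y ⟩ + t * t * ‖ y ‖²)
    ≡⟨ lemma ‖ x ‖² t ⟨ x , y ⟩ ‖ y ‖² ⟩
  ‖ x ‖² + + 2 * t * ⟨ x , y ⟩ + t * t * ‖ y ‖² ∎
  where open ≡-Reasoning
        lemma : ∀ p t q r → (p + t * q) + (t * q + t * t * r) ≡ p + + 2 * t * q + t * t * r
        lemma = solve-∀

∧-⌟-adjoint : ∀ {k m} (v : Vector ℤ m) (x : Λ (suc k) m) (y : Λ k m) → ⟨ x , v ∧ y ⟩ ≡ ⟨ v ⌟ x , y ⟩
∧-⌟-adjoint {k}     {zero}  v x        y = sym (⟨⟩-0ˡ y)
∧-⌟-adjoint {zero}  {suc m} v (x , x′) y = begin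
  ⟨ x , tail v ∧ y ⟩ + x′ * (head v * y) ≡⟨ cong (_+ x′ * (head v * y)) (∧-⌟-adjoint (tail v) x y) ⟩
  (tail v ⌟ x) * y + x′ * (head v * y)   ≡⟨ lemma (tail v ⌟ x) x′ (head v) y ⟩
  (tail v ⌟ x + head v * x′) * y         ∎
  where open ≡-Reasoning
        lemma : ∀ p q a y → p * y + q * (a * y) ≡ (p + a * q) * y
        lemma = solve-∀
∧-⌟-adjoint {suc k} {suc m} v (x , x′) (y , y′) = begin
  ⟨ x , v′ ∧ y ⟩ + ⟨ x′ , a ⊙ y ⊕ -1ℤ ⊙ (v′ ∧ y′) ⟩
    ≡⟨ cong (_+_ ⟨ x , v′ ∧ y ⟩) (⟨⟩-⊕ʳ x′ (a ⊙ y) (-1ℤ ⊙ (v′ ∧ y′))) ⟩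
  ⟨ x , v′ ∧ y ⟩ + (⟨ x′ , a ⊙ y ⟩ + ⟨ x′ , -1ℤ ⊙ (v′ ∧ y′) ⟩)
    ≡⟨ cong₂ (λ p q → ⟨ x , v′ ∧ y ⟩ + (p + q)) (⟨⟩-⊙ʳ a x′ y) (⟨⟩-⊙ʳ -1ℤ x′ (v′ ∧ y′)) ⟩
  ⟨ x , v′ ∧ y ⟩ + (a * ⟨ x′ , y ⟩ + -1ℤ * ⟨ x′ , v′ ∧ y′ ⟩)
    ≡⟨ cong₂ (λ p q → p + (a * ⟨ x′ , y ⟩ + -1ℤ * q)) (∧-⌟-adjoint v′ x y) (∧-⌟-adjoint v′ x′ y′) ⟩
  ⟨ v′ ⌟ x , y ⟩ + (a * ⟨ x′ , y ⟩ + -1ℤ * ⟨ v′ ⌟ x′ , y′ ⟩)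
    ≡⟨ ℤP.+-assoc ⟨ v′ ⌟ x , y ⟩ (a * ⟨ x′ , y ⟩) (-1ℤ * ⟨ v′ ⌟ x′ , y′ ⟩) ⟨
  ⟨ v′ ⌟ x , y ⟩ + a * ⟨ x′ , y ⟩ + -1ℤ * ⟨ v′ ⌟ x′ , y′ ⟩
    ≡⟨ cong₂ (λ p q → ⟨ v′ ⌟ x , y ⟩ + p + q) (⟨⟩-⊙ˡ a x′ y) (⟨⟩-⊙ˡ -1ℤ (v′ ⌟ x′) y′) ⟨
  ⟨ v′ ⌟ x , y ⟩ + ⟨ a ⊙ x′ , y ⟩ + ⟨ -1ℤ ⊙ (v′ ⌟ x′) , y′ ⟩
    ≡⟨ cong (_+ ⟨ -1ℤ ⊙ (v′ ⌟ x′) , y′ ⟩) (⟨⟩-⊕ˡ (v′ ⌟ x) (a ⊙ x′) y) ⟨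
  ⟨ v′ ⌟ x ⊕ a ⊙ x′ , y ⟩ + ⟨ -1ℤ ⊙ (v′ ⌟ x′) , y′ ⟩ ∎
  where open ≡-Reasoning
        a  = head v
        v′ = tail v

‖v∧c‖² : ∀ {m} (v : Vector ℤ m) (c : ℤ) → ‖ v ∧ c ‖² ≡ (v · v) * (c * c)
‖v∧c‖² {zero}  v c = refl
‖v∧c‖² {suc m} v c = begin
  ‖ tail v ∧ c ‖² + head v * c * (head v * c)  ≡⟨ cong (_+ head v * c * (head v * c)) (‖v∧c‖² (tail v) c) ⟩
  (tail v · tail v) * (c * c) + head v * c * (head v * c) ≡⟨ lemma (head v) (tail v · tail v) c ⟩
  (head v * head v + tail v · tail v) * (c * c) ∎
  where open ≡-Reasoning
        lemma : ∀ a n c → n * (c * c) + a * c * (a * c) ≡ (a * a + n) * (c * c)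
        lemma = solve-∀

‖a⊙x⊕-v∧y‖² : ∀ {k m} (a : ℤ) (v : Vector ℤ m) (x : Λ (suc k) m) (y : Λ k m) →
              ‖ a ⊙ x ⊕ -1ℤ ⊙ (v ∧ y) ‖² ≡ a * a * ‖ x ‖² - + 2 * a * ⟨ v ⌟ x , y ⟩ + ‖ v ∧ y ‖²
‖a⊙x⊕-v∧y‖² a v x y = begin
  ‖ a ⊙ x ⊕ -1ℤ ⊙ (v ∧ y) ‖²
    ≡⟨ ‖⊕⊙‖² (a ⊙ x) -1ℤ (v ∧ y) ⟩
  ‖ a ⊙ x ‖² + + 2 * -1ℤ * ⟨ a ⊙ x , v ∧ y ⟩ + -1ℤ * -1ℤ * ‖ v ∧ y ‖²
    ≡⟨ cong₂ (λ p q → p + + 2 * -1ℤ * q + -1ℤ * -1ℤ * ‖ v ∧ y ‖²) (‖⊙‖² a x)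
             (trans (⟨⟩-⊙ˡ a x (v ∧ y)) (cong (a *_) (∧-⌟-adjoint v x y))) ⟩
  a * a * ‖ x ‖² + + 2 * -1ℤ * (a * ⟨ v ⌟ x , y ⟩) + -1ℤ * -1ℤ * ‖ v ∧ y ‖²
    ≡⟨ lemma a ‖ x ‖² ⟨ v ⌟ x , y ⟩ ‖ v ∧ y ‖² ⟩
  a * a * ‖ x ‖² - + 2 * a * ⟨ v ⌟ x , y ⟩ + ‖ v ∧ y ‖² ∎
  where open ≡-Reasoning
        lemma : ∀ a p j q → a * a * p + + 2 * -1ℤ * (a * j) + -1ℤ * -1ℤ * q ≡ a * a * p - + 2 * a * j + q
        lemma = solve-∀

-- In the inductive step the cross terms ∓ 2 v₀ ⟨v′ ⌟ w , w′⟩ of ‖ v ∧ w ‖² and ‖ v ⌟ w ‖² cancel.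
lagrange : ∀ {k m} (v : Vector ℤ m) (w : Λ (suc k) m) → ‖ v ∧ w ‖² + ‖ v ⌟ w ‖² ≡ (v · v) * ‖ w ‖²
lagrange {k}     {zero}  v w = trans (ℤP.+-identityˡ _) (⟨⟩-0ˡ {k} {zero} 0Λ)
lagrange {zero}  {suc m} v (w , c) = begin
  ‖ v′ ∧ w ‖² + ‖ a ⊙ w ⊕ -1ℤ ⊙ (v′ ∧ c) ‖² + (v′ ⌟ w + a * c) * (v′ ⌟ w + a * c)
    ≡⟨ cong (λ p → ‖ v′ ∧ w ‖² + p + (v′ ⌟ w + a * c) * (v′ ⌟ w + a * c))
            (trans (‖a⊙x⊕-v∧y‖² a v′ w c) (cong (_+_ (a * a * ‖ w ‖² - + 2 * a * ((v′ ⌟ w) * c))) (‖v∧c‖² v′ c))) ⟩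
  ‖ v′ ∧ w ‖² + (a * a * ‖ w ‖² - + 2 * a * ((v′ ⌟ w) * c) + (v′ · v′) * (c * c)) + (v′ ⌟ w + a * c) * (v′ ⌟ w + a * c)
    ≡⟨ regroup a (v′ · v′) ‖ v′ ∧ w ‖² (v′ ⌟ w) ‖ w ‖² c ⟩
  (‖ v′ ∧ w ‖² + (v′ ⌟ w) * (v′ ⌟ w)) + (a * a * ‖ w ‖² + (a * a + v′ · v′) * (c * c))
    ≡⟨ cong (_+ (a * a * ‖ w ‖² + (a * a + v′ · v′) * (c * c))) (lagrange v′ w) ⟩
  (v′ · v′) * ‖ w ‖² + (a * a * ‖ w ‖² + (a * a + v′ · v′) * (c * c))
    ≡⟨ collect a (v′ · v′) ‖ w ‖² c ⟩
  (a * a + v′ · v′) * (‖ w ‖² + c * c) ∎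
  where open ≡-Reasoning
        a  = head v
        v′ = tail v
        regroup : ∀ a n p i q c → p + (a * a * q - + 2 * a * (i * c) + n * (c * c)) + (i + a * c) * (i + a * c)
                                 ≡ (p + i * i) + (a * a * q + (a * a + n) * (c * c))
        regroup = solve-∀
        collect : ∀ a n q c → n * q + (a * a * q + (a * a + n) * (c * c)) ≡ (a * a + n) * (q + c * c)
        collect = solve-∀
lagrange {suc k} {suc m} v (w , w′) = begin
  ‖ v′ ∧ w ‖² + ‖ a ⊙ w ⊕ -1ℤ ⊙ (v′ ∧ w′) ‖² + (‖ v′ ⌟ w ⊕ a ⊙ w′ ‖² + ‖ -1ℤ ⊙ (v′ ⌟ w′) ‖²)
    ≡⟨ cong₂ (λ p q → ‖ v′ ∧ w ‖² + p + q) (‖a⊙x⊕-v∧y‖² a v′ w w′)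
             (cong₂ _+_ (‖⊕⊙‖² (v′ ⌟ w) a w′) (‖⊙‖² -1ℤ (v′ ⌟ w′))) ⟩
  ‖ v′ ∧ w ‖² + (a * a * ‖ w ‖² - + 2 * a * J + ‖ v′ ∧ w′ ‖²)
    + (‖ v′ ⌟ w ‖² + + 2 * a * J + a * a * ‖ w′ ‖² + -1ℤ * -1ℤ * ‖ v′ ⌟ w′ ‖²)
    ≡⟨ regroup a ‖ v′ ∧ w ‖² ‖ v′ ⌟ w ‖² ‖ v′ ∧ w′ ‖² ‖ v′ ⌟ w′ ‖² ‖ w ‖² ‖ w′ ‖² J ⟩
  (‖ v′ ∧ w ‖² + ‖ v′ ⌟ w ‖²) + (‖ v′ ∧ w′ ‖² + ‖ v′ ⌟ w′ ‖²) + a * a * (‖ w ‖² + ‖ w′ ‖²)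
    ≡⟨ cong₂ (λ p q → p + q + a * a * (‖ w ‖² + ‖ w′ ‖²)) (lagrange v′ w) (lagrange v′ w′) ⟩
  (v′ · v′) * ‖ w ‖² + (v′ · v′) * ‖ w′ ‖² + a * a * (‖ w ‖² + ‖ w′ ‖²)
    ≡⟨ collect a (v′ · v′) ‖ w ‖² ‖ w′ ‖² ⟩
  (a * a + v′ · v′) * (‖ w ‖² + ‖ w′ ‖²) ∎
  where open ≡-Reasoning
        a  = head v
        v′ = tail v
        J  = ⟨ v′ ⌟ w , w′ ⟩
        regroup : ∀ a A B C D q r j → A + (a * a * q - + 2 * a * j + C) + (B + + 2 * a * j + a * a * r + -1ℤ * -1ℤ * D)
                                     ≡ (A + B) + (C + D) + a * a * (q + r)
        regroup = solve-∀
        collect : ∀ a n q r → n * q + n * r + a * a * (q + r) ≡ (a * a + n) * (q + r)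
        collect = solve-∀

‖‖²≥0 : ∀ {k m} (x : Λ k m) → + 0 ≤ ‖ x ‖²
‖‖²≥0 {zero}          x       = x*x≥0 x
‖‖²≥0 {suc k} {zero}  _       = ℤP.≤-refl
‖‖²≥0 {suc k} {suc m} (x , y) = ℤP.+-mono-≤ (‖‖²≥0 x) (‖‖²≥0 y)

v·v≥0 : ∀ {m} (v : Vector ℤ m) → + 0 ≤ v · v
v·v≥0 {zero}  v = ℤP.≤-refl
v·v≥0 {suc m} v = ℤP.+-mono-≤ (x*x≥0 (head v)) (v·v≥0 (tail v))

‖v∧w‖²≤ : ∀ {k m} (v : Vector ℤ m) (w : Λ k m) → ‖ v ∧ w ‖² ≤ (v · v) * ‖ w ‖²
‖v∧w‖²≤ {zero}  v w = ℤP.≤-reflexive (‖v∧c‖² v w)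
‖v∧w‖²≤ {suc k} v w = ℤP.≤-trans (ℤP.i≤i+j _ _ {{nonNegative (‖‖²≥0 (v ⌟ w))}}) (ℤP.≤-reflexive (lagrange v w))

v⌟w∧c : ∀ {m} (v w : Vector ℤ m) (c : ℤ) → v ⌟ w ∧ c ≡ (v · w) * c
v⌟w∧c {zero}  v w c = refl
v⌟w∧c {suc m} v w c = begin
  tail v ⌟ tail w ∧ c + head v * (head w * c) ≡⟨ cong (_+ head v * (head w * c)) (v⌟w∧c (tail v) (tail w) c) ⟩
  (tail v · tail w) * c + head v * (head w * c) ≡⟨ lemma (head v) (head w) (tail v · tail w) c ⟩
  (head v * head w + tail v · tail w) * c       ∎
  where open ≡-Reasoning
        lemma : ∀ a b d c → d * c + a * (b * c) ≡ (a * b + d) * c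
        lemma = solve-∀

gram : ∀ {m} → Vector ℤ m → Vector ℤ m → ℤ
gram a b = (a · a) * (b · b) - (a · b) * (a · b)

∏‖_‖² : ∀ {r m} → (Fin r → Vector ℤ m) → ℤ
∏‖ ys ‖² = ∏ (λ i → ys i · ys i)

‖a∧b‖² : ∀ {m} (a b : Vector ℤ m) → ‖ a ∧ b ∧ + 1 ‖² ≡ gram a b
‖a∧b‖² a b = begin
  N
    ≡⟨ solve₁ N I ⟩
  N + I * I - I * I
    ≡⟨ cong (_- I * I) (lagrange a (b ∧ + 1)) ⟩
  (a · a) * ‖ b ∧ + 1 ‖² - I * I
    ≡⟨ cong₂ (λ p q → (a · a) * p - q * q) (‖v∧c‖² b (+ 1)) (v⌟w∧c a b (+ 1)) ⟩
  (a · a) * ((b · b) * (+ 1 * + 1)) - (a · b) * + 1 * ((a · b) * + 1)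
    ≡⟨ solve₂ (a · a) (b · b) (a · b) ⟩
  gram a b ∎
  where
  open ≡-Reasoning
  N = ‖ a ∧ b ∧ + 1 ‖²
  I = a ⌟ b ∧ + 1
  solve₁ : ∀ n i → n ≡ n + i * i - i * i
  solve₁ = solve-∀
  solve₂ : ∀ p q d → p * (q * (+ 1 * + 1)) - d * + 1 * (d * + 1) ≡ p * q - d * d
  solve₂ = solve-∀

‖a∧b∧⋀‖²≤ : ∀ {r m} (a b : Vector ℤ m) (ys : Fin r → Vector ℤ m) → ‖ a ∧ b ∧ ⋀ ys ‖² ≤ gram a b * ∏‖ ys ‖²
‖a∧b∧⋀‖²≤ {zero}  a b ys = ℤP.≤-reflexive (trans (‖a∧b‖² a b) (sym (ℤP.*-identityʳ (gram a b))))
‖a∧b∧⋀‖²≤ {suc r} a b ys = begin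
  ‖ a ∧ b ∧ y ∧ W ‖²
    ≡⟨ cong ‖_‖² (∧-rotate a b y W) ⟩
  ‖ y ∧ a ∧ b ∧ W ‖²
    ≤⟨ ‖v∧w‖²≤ y (a ∧ b ∧ W) ⟩
  (y · y) * ‖ a ∧ b ∧ W ‖²
    ≤⟨ ℤP.*-monoˡ-≤-nonNeg (y · y) {{nonNegative (v·v≥0 y)}} (‖a∧b∧⋀‖²≤ a b (tail ys)) ⟩
  (y · y) * (gram a b * ∏‖ tail ys ‖²)
    ≡⟨ swap (y · y) (gram a b) ∏‖ tail ys ‖² ⟩
  gram a b * ((y · y) * ∏‖ tail ys ‖²) ∎
  where
  open ℤP.≤-Reasoning
  y = head ys
  W = ⋀ (tail ys)
  swap : ∀ p q r → p * (q * r) ≡ q * (p * r)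
  swap = solve-∀

-- Determinants

-- The coordinate of e₀ ∧ ⋯ ∧ eₖ₋₁.
top : ∀ {k} → Λ k k → ℤ
top {zero}  x       = x
top {suc k} (_ , y) = top y

top-⊕ : ∀ {k} (x y : Λ k k) → top (x ⊕ y) ≡ top x + top y
top-⊕ {zero}  x       y       = refl
top-⊕ {suc k} (_ , x) (_ , y) = top-⊕ x y

top-⊙ : ∀ {k} (s : ℤ) (x : Λ k k) → top (s ⊙ x) ≡ s * top x
top-⊙ {zero}  s x       = refl
top-⊙ {suc k} s (_ , x) = top-⊙ s x

top-0Λ : ∀ {k} → top (0Λ {k} {k}) ≡ + 0
top-0Λ {zero}  = refl
top-0Λ {suc k} = top-0Λ {k}

top-∑Λ : ∀ {n k} (f : Fin n → Λ k k) → top (∑Λ f) ≡ sumF (λ i → top (f i))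
top-∑Λ {zero}  {k} f = top-0Λ {k}
top-∑Λ {suc n}     f = trans (top-⊕ (head f) (∑Λ (tail f))) (cong (_+_ (top (head f))) (top-∑Λ (tail f)))

top*top≤‖‖² : ∀ {k} (x : Λ k k) → top x * top x ≤ ‖ x ‖²
top*top≤‖‖² {zero}  x       = ℤP.≤-refl
top*top≤‖‖² {suc k} (x , y) = ℤP.≤-trans (top*top≤‖‖² y) (ℤP.i≤j+i _ _ {{nonNegative (‖‖²≥0 x)}})

-- proj₂ is the e₀-component, so this is the Laplace expansion along the first row.
⋀-laplace : ∀ {k m} (c : Fin (suc k) → Vector ℤ (suc m)) →
            proj₂ (⋀ c) ≡ ∑Λ (λ j → (sgn (toℕ j) * head (c j)) ⊙ ⋀ (tail ∘ removeAt c j))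
⋀-laplace {zero} c = lemma (head (head c))
  where lemma : ∀ a → a * + 1 ≡ + 1 * a * + 1 + + 0
        lemma = solve-∀
⋀-laplace {suc k} {m} c = cong₂ _⊕_ first rest
  where
  v = tail (head c)
  first : head (head c) ⊙ proj₁ (⋀ (tail c)) ≡ (+ 1 * head (head c)) ⊙ ⋀ (tail ∘ tail c)
  first = cong₂ _⊙_ (sym (ℤP.*-identityˡ (head (head c)))) (⋀-tails (tail c))
  rest : -1ℤ ⊙ v ∧ proj₂ (⋀ (tail c))
       ≡ ∑Λ (λ j → (sgn (suc (toℕ j)) * head (c (suc j))) ⊙ ⋀ (tail ∘ removeAt c (suc j)))
  rest = begin
    -1ℤ ⊙ v ∧ proj₂ (⋀ (tail c))
      ≡⟨ cong (λ t → -1ℤ ⊙ v ∧ t) (⋀-laplace (tail c)) ⟩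
    -1ℤ ⊙ v ∧ ∑Λ (λ j → s j ⊙ W j)
      ≡⟨ cong (-1ℤ ⊙_) (∧-∑Λ v (λ j → s j ⊙ W j)) ⟩
    -1ℤ ⊙ ∑Λ (λ j → v ∧ s j ⊙ W j)
      ≡⟨ ⊙-∑Λ -1ℤ (λ j → v ∧ s j ⊙ W j) ⟩
    ∑Λ (λ j → -1ℤ ⊙ v ∧ s j ⊙ W j)
      ≡⟨ ∑Λ-cong (λ j → trans (cong (-1ℤ ⊙_) (∧-⊙ v (s j) (W j))) (⊙-assoc -1ℤ (s j) (v ∧ W j))) ⟩
    ∑Λ (λ j → (-1ℤ * s j) ⊙ v ∧ W j)
      ≡⟨ ∑Λ-cong (λ j → cong (_⊙ v ∧ W j) (sign-shift j)) ⟩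
    ∑Λ (λ j → (sgn (suc (toℕ j)) * head (c (suc j))) ⊙ v ∧ W j) ∎
    where
    open ≡-Reasoning
    s : Fin (suc k) → ℤ
    s j = sgn (toℕ j) * head (c (suc j))
    W : Fin (suc k) → Λ k m
    W j = ⋀ (tail ∘ removeAt (tail c) j)
    sign-shift : ∀ j → -1ℤ * s j ≡ sgn (suc (toℕ j)) * head (c (suc j))
    sign-shift j = trans (sym (ℤP.*-assoc -1ℤ (sgn (toℕ j)) (head (c (suc j)))))
                         (cong (_* head (c (suc j))) (sym (sgn-suc (toℕ j))))

column : ∀ {n} → Matrix n → Fin n → Vector ℤ n
column M j i = M i j

top-⋀-column : ∀ {n} (M : Matrix n) → top (⋀ (column M)) ≡ det M
top-⋀-column {zero}  M = refl
top-⋀-column {suc n} M = begin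
  top (proj₂ (⋀ (column M)))                             ≡⟨ cong top (⋀-laplace (column M)) ⟩
  top (∑Λ (λ j → s j ⊙ ⋀ (column (minor j))))             ≡⟨ top-∑Λ (λ j → s j ⊙ ⋀ (column (minor j))) ⟩
  sumF (λ j → top (s j ⊙ ⋀ (column (minor j))))           ≡⟨ sumF-cong (λ j → top-⊙ (s j) (⋀ (column (minor j)))) ⟩
  sumF (λ j → s j * top (⋀ (column (minor j))))           ≡⟨ sumF-cong (λ j → cong (s j *_) (top-⋀-column (minor j))) ⟩
  sumF (λ j → s j * det (minor j))                        ∎
  where
  open ≡-Reasoning
  s : Fin (suc n) → ℤ
  s j = sgn (toℕ j) * M zero j
  minor : Fin (suc n) → Matrix n
  minor j r c = M (suc r) (punchIn j c)

-- Fischer's inequality for two distinguished columns, which we may move to the front.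
det*det≤gram*∏ : ∀ {k} (M : Matrix (suc (suc k))) (i : Fin (suc (suc k))) (j : Fin (suc k)) →
                 det M * det M ≤ gram (column M i) (column M (punchIn i j)) * ∏‖ removeAt (removeAt (column M) i) j ‖²
det*det≤gram*∏ M i j = begin
  det M * det M
    ≡⟨ cong (λ d → d * d) (top-⋀-column M) ⟨
  top (⋀ c) * top (⋀ c)
    ≤⟨ top*top≤‖‖² (⋀ c) ⟩
  ‖ ⋀ c ‖²
    ≡⟨ cong ‖_‖² (trans (⋀-extract c i) (cong (λ w → sgn (toℕ i) ⊙ a ∧ w) (⋀-extract c′ j))) ⟩
  ‖ sgn (toℕ i) ⊙ a ∧ sgn (toℕ j) ⊙ b ∧ W ‖²
    ≡⟨ ‖sgn⊙‖² (toℕ i) (a ∧ sgn (toℕ j) ⊙ b ∧ W) ⟩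
  ‖ a ∧ sgn (toℕ j) ⊙ b ∧ W ‖²
    ≡⟨ cong ‖_‖² (∧-⊙ a (sgn (toℕ j)) (b ∧ W)) ⟩
  ‖ sgn (toℕ j) ⊙ a ∧ b ∧ W ‖²
    ≡⟨ ‖sgn⊙‖² (toℕ j) (a ∧ b ∧ W) ⟩
  ‖ a ∧ b ∧ W ‖²
    ≤⟨ ‖a∧b∧⋀‖²≤ a b (removeAt c′ j) ⟩
  gram a b * ∏‖ removeAt c′ j ‖² ∎
  where
  open ℤP.≤-Reasoning
  c  = column M
  c′ = removeAt c i
  a  = c i
  b  = c′ j
  W  = ⋀ (removeAt c′ j)

-- Seidel matrices of tournaments

IsSign : ℤ → Set
IsSign x = x ≡ + 1 ⊎ x ≡ -1ℤ

sign*sign : ∀ {x} → IsSign x → x * x ≡ + 1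
sign*sign (inj₁ refl) = refl
sign*sign (inj₂ refl) = refl

sign*sign-isSign : ∀ {x y} → IsSign x → IsSign y → IsSign (x * y)
sign*sign-isSign (inj₁ refl) (inj₁ refl) = inj₁ refl
sign*sign-isSign (inj₁ refl) (inj₂ refl) = inj₂ refl
sign*sign-isSign (inj₂ refl) (inj₁ refl) = inj₂ refl
sign*sign-isSign (inj₂ refl) (inj₂ refl) = inj₁ refl

sumF-signs-parity : ∀ {n} (f : Fin n → ℤ) → (∀ i → IsSign (f i)) → + 2 ∣ℤ sumF f + + n
sumF-signs-parity {zero}  f signs = divides (+ 0) refl
sumF-signs-parity {suc n} f signs =
  subst (+ 2 ∣ℤ_) (regroup (head f) (sumF (tail f)) (+ n))
        (∣m∣n⇒∣m+n (sign+1-even (signs zero)) (sumF-signs-parity (tail f) (signs ∘ suc)))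
  where
  sign+1-even : ∀ {x} → IsSign x → + 2 ∣ℤ x + + 1
  sign+1-even (inj₁ refl) = ∣-refl
  sign+1-even (inj₂ refl) = divides (+ 0) refl
  regroup : ∀ a s r → a + + 1 + (s + r) ≡ a + s + (+ 1 + r)
  regroup = solve-∀

1≤x*x : ∀ {x} → x ≢ + 0 → + 1 ≤ x * x
1≤x*x {+ zero}     x≢0 = ⊥-elim (x≢0 refl)
1≤x*x {+ suc n}    _   = +≤+ (s≤s z≤n)
1≤x*x {ℤ.-[1+ n ]} _   = +≤+ (s≤s z≤n)

even≢0⇒4≤x*x : ∀ {x} → + 2 ∣ℤ x → x ≢ + 0 → + 4 ≤ x * x
even≢0⇒4≤x*x (divides q refl) x≢0 = begin
  + 4                       ≡⟨ ℤP.*-identityʳ (+ 4) ⟨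
  + 4 * + 1                 ≤⟨ ℤP.*-monoˡ-≤-nonNeg (+ 4) (1≤x*x {q} (λ q≡0 → x≢0 (cong (_* + 2) q≡0))) ⟩
  + 4 * (q * q)             ≡⟨ lemma q ⟩
  q * + 2 * (q * + 2)       ∎
  where
  open ℤP.≤-Reasoning
  lemma : ∀ q → + 4 * (q * q) ≡ q * + 2 * (q * + 2)
  lemma = solve-∀

module Seidel {n : ℕ} (T : Fin n → Fin n → Bool) (tour : IsTournament T) where

  S : Matrix n
  S = seidel T

  seidel-diag : ∀ i → S i i ≡ + 0
  seidel-diag i with i ≟ i
  ... | yes _   = refl
  ... | no i≢i = ⊥-elim (i≢i refl)

  seidel-off : ∀ {i j} → i ≢ j → S i j ≡ (if T i j then + 1 else -1ℤ)
  seidel-off {i} {j} i≢j with i ≟ j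
  ... | yes i≡j = ⊥-elim (i≢j i≡j)
  ... | no _    = refl

  seidel-sign : ∀ {i j} → i ≢ j → IsSign (S i j)
  seidel-sign {i} {j} i≢j rewrite seidel-off i≢j with T i j
  ... | true  = inj₁ refl
  ... | false = inj₂ refl

  seidel-trit : ∀ i j → IsTrit (S i j)
  seidel-trit i j = case i ≟ j of λ where
    (yes refl) → inj₁ (seidel-diag i)
    (no i≢j)   → inj₂ (seidel-sign i≢j)

  seidel-skew-off : ∀ {i j} → i ≢ j → S j i ≡ - S i j
  seidel-skew-off {i} {j} i≢j rewrite seidel-off i≢j | seidel-off (i≢j ∘ sym) | proj₂ tour i j i≢j with T j i
  ... | true  = refl
  ... | false = refl

  seidel-skew : ∀ i j → S j i ≡ - S i j
  seidel-skew i j = case i ≟ j of λ where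
    (yes refl) → trans (seidel-diag i) (cong -_ (sym (seidel-diag i)))
    (no i≢j)   → seidel-skew-off i≢j

  column·column : ∀ i j → column S i · column S j ≡ S i · S j
  column·column i j = sumF-cong (λ r → trans (cong₂ _*_ (seidel-skew i r) (seidel-skew j r)) (neg*neg (S i r) (S j r)))
    where neg*neg : ∀ a b → - a * - b ≡ a * b
          neg*neg = solve-∀

module SeidelRows {n : ℕ} (T : Fin (suc n) → Fin (suc n) → Bool) (tour : IsTournament T) where
  open Seidel T tour

  seidel-row-norm : ∀ i → S i · S i ≡ + n
  seidel-row-norm i = begin
    S i · S i                                                   ≡⟨ sumF-removeAt (λ k → S i k * S i k) i ⟩
    S i i * S i i + sumF (λ t → S i (punchIn i t) * S i (punchIn i t))
      ≡⟨ cong₂ (λ d s → d * d + s) (seidel-diag i) (sumF-ones (λ t → sign*sign (seidel-sign (punchInᵢ≢i i t ∘ sym)))) ⟩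
    + n                                                         ∎
    where open ≡-Reasoning

  seidel-isSkewConference : (∀ i j → S i · S (punchIn i j) ≡ + 0) → IsSkewConference S
  seidel-isSkewConference orthogonal = seidel-skew , seidel-trit , rows
    where
    rows : ∀ i j → S i · S j ≡ (if isYes (i ≟ j) then + n else + 0)
    rows i j with i ≟ j
    ... | yes refl = seidel-row-norm i
    ... | no i≢j   = subst (λ j → S i · S j ≡ + 0) (punchIn-punchOut i≢j) (orthogonal i (punchOut i≢j))

module SeidelParity {k : ℕ} (T : Fin (suc (suc k)) → Fin (suc (suc k)) → Bool) (tour : IsTournament T) where
  open Seidel T tour

  -- Off the columns i and punchIn i j, the k products S i t * S (punchIn i j) t are all ±1.
  seidel-row-dot-parity : ∀ i (j : Fin (suc k)) → + 2 ∣ℤ S i · S (punchIn i j) + + k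
  seidel-row-dot-parity i j = subst (λ G → + 2 ∣ℤ G + + k) (sym row-dot-split) (sumF-signs-parity (g ∘ others) signs)
    where
    j′ = punchIn i j
    g : Fin (suc (suc k)) → ℤ
    g t = S i t * S j′ t
    others : Fin k → Fin (suc (suc k))
    others u = punchIn i (punchIn j u)
    row-dot-split : S i · S j′ ≡ sumF (g ∘ others)
    row-dot-split = begin
      sumF g                             ≡⟨ sumF-removeAt g i ⟩
      g i + sumF (removeAt g i)          ≡⟨ cong (_+_ (g i)) (sumF-removeAt (removeAt g i) j) ⟩
      g i + (g j′ + sumF (g ∘ others))   ≡⟨ cong₂ (λ p q → p + (q + sumF (g ∘ others))) gᵢ≡0 gⱼ≡0 ⟩
      + 0 + (+ 0 + sumF (g ∘ others))    ≡⟨ trans (ℤP.+-identityˡ _) (ℤP.+-identityˡ _) ⟩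
      sumF (g ∘ others)                  ∎
      where
      open ≡-Reasoning
      gᵢ≡0 : g i ≡ + 0
      gᵢ≡0 = cong (_* S j′ i) (seidel-diag i)
      gⱼ≡0 : g j′ ≡ + 0
      gⱼ≡0 = trans (cong (S i j′ *_) (seidel-diag j′)) (ℤP.*-zeroʳ (S i j′))
    signs : ∀ u → IsSign (g (others u))
    signs u = sign*sign-isSign (seidel-sign (punchInᵢ≢i i (punchIn j u) ∘ sym))
                               (seidel-sign (λ j′≡ → punchInᵢ≢i j u (sym (punchIn-injective i j (punchIn j u) j′≡))))

seidel-det-bound : ∀ {n} (T : Fin (suc n) → Fin (suc n) → Bool) → IsTournament T → 2 ∣ suc n →
                   ∀ i (j : Fin n) → seidel T i · seidel T (punchIn i j) ≢ + 0 →
                   det (seidel T) * det (seidel T) ≤ + (n ^ (suc n ∸ 2)) * (+ (n ^ 2) - + 4)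
seidel-det-bound {suc k} T tour 2∣n i j G≢0 = begin
  det S * det S
    ≤⟨ det*det≤gram*∏ S i j ⟩
  gram (column S i) (column S j′) * ∏‖ removeAt (removeAt (column S) i) j ‖²
    ≡⟨ cong₂ _*_ gram≡ (∏-const (λ t → column-norm (punchIn i (punchIn j t)))) ⟩
  (+ N * + N - G * G) * + (N ^ k)
    ≤⟨ ℤP.*-monoʳ-≤-nonNeg (+ (N ^ k)) (ℤP.+-monoʳ-≤ (+ N * + N) (ℤP.neg-mono-≤ 4≤G*G)) ⟩
  (+ N * + N - + 4) * + (N ^ k)
    ≡⟨ ℤP.*-comm (+ N * + N - + 4) (+ (N ^ k)) ⟩
  + (N ^ k) * (+ N * + N - + 4)
    ≡⟨ cong (λ N² → + (N ^ k) * (N² - + 4)) N*N≡N^2 ⟩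
  + (N ^ k) * (+ (N ^ 2) - + 4) ∎
  where
  open ℤP.≤-Reasoning
  open Seidel T tour
  open SeidelRows T tour
  open SeidelParity T tour
  N  = suc k
  j′ = punchIn i j
  G  = S i · S j′
  column-norm : ∀ l → column S l · column S l ≡ + N
  column-norm l = trans (column·column l l) (seidel-row-norm l)
  gram≡ : gram (column S i) (column S j′) ≡ + N * + N - G * G
  gram≡ = cong₂ _-_ (cong₂ _*_ (column-norm i) (column-norm j′)) (cong (λ d → d * d) (column·column i j′))
  G-even : + 2 ∣ℤ G
  G-even = ∣m+n∣n⇒∣m (seidel-row-dot-parity i j) (∣ᵤ⇒∣ (ℕ∣.∣m+n∣m⇒∣n 2∣n (ℕ∣.∣-refl {2})))
  4≤G*G : + 4 ≤ G * G
  4≤G*G = even≢0⇒4≤x*x G-even G≢0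
  N*N≡N^2 : + N * + N ≡ + (N ^ 2)
  N*N≡N^2 = trans (sym (ℤP.pos-* N N)) (cong (λ M → + (N ℕ.* M)) (sym (ℕP.*-identityʳ N)))

theorem6p1 : (n : ℕ) → 2 ∣ n → n ≥ 1 → (T : Fin n → Fin n → Bool) → IsTournament T →
    IsSkewConference (seidel T) ⊎
      (det (seidel T) ≤ + 0 ⊎
        det (seidel T) * det (seidel T) ≤ + ((n ∸ 1) ^ (n ∸ 2)) * (+ ((n ∸ 1) ^ 2) - + 4))
theorem6p1 zero    _   ()  T tour
theorem6p1 (suc n) 2∣n _ T tour with any? (λ i → any? (λ j → ¬? (seidel T i · seidel T (punchIn i j) ℤ.≟ + 0)))
... | yes (i , j , G≢0) = inj₂ (inj₂ (seidel-det-bound T tour 2∣n i j G≢0))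
... | no ∄G≢0           = inj₁ (SeidelRows.seidel-isSkewConference T tour
                                  λ i j → decidable-stable (_ ℤ.≟ _) λ G≢0 → ∄G≢0 (i , j , G≢0))
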